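{- Let $G$ be a convex graph with $n$ vertices. Then $\mathrm{boolw}(G)\le\log_2 n$.
   Context: For a bipartite graph $B=(X,Y,E)$, an ordering $<$ of $X$ has the adjacency property if for every $y\in Y$ the set $N(y)$ consists of vertices that are consecutive in the ordering $<$ of $X$. A bipartite graph $(X,Y,E)$ is convex if there is an ordering of $X$ or of $Y$ satisfying the adjacency property (with the roles of $X$ and $Y$ exchanged in the latter case). For $A\subseteq V(G)$ write $\overline{A}=V(G)\setminus A$. A decomposition tree of $G$ is a pair $(T,\delta)$ where $T$ is a tree whose internal nodes have degree three and which has $|V(G)|$ leaves, and $\delta$ is a bijection between $V(G)$ and the leaves of $T$; each edge of $T$ defines a cut $\{A,\overline{A}\}$ given by the leaves of the two components of $T$ minus that edge. Define $\mathrm{cut\text{ - }bool}(A)=\log_2|\{S\subseteq\overline{A} : \exists X\subseteq A,\ S=\overline{A}\cap\bigcup_{x\in X}N(x)\}|$. The boolean-width of $(T,\delta)$ is the maximum of $\mathrm{cut\text{ - }bool}(A)$ over cuts given by edges of $T$, and $\mathrm{boolw}(G)$ is the minimum over all decomposition trees of $G$. -}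

module Defs where

open import Data.Bool using (Bool; true; false; _∧_; _∨_; not)
open import Data.Bool.Properties using () renaming (_≟_ to _≟ᵇ_)
open import Data.Nat using (ℕ; _<_; _≤_)
open import Data.Fin using (Fin)
open import Data.Fin.Subset using (Subset; _∩_; _∪_; ∁; ⁅_⁆)
open import Data.Fin.Subset.Properties using (_⊆?_)
open import Data.Bool.ListAction using (any)
open import Data.Vec using (Vec; []; _∷_; tabulate)
open import Data.Vec.Properties using (≡-dec)
open import Data.List using (List; []; _∷_; map; filter; length; deduplicate; _++_; allFin)
open import Data.List.Relation.Binary.Permutation.Propositional using (_↭_)
open import Data.Product using (Σ; ∃; ∃-syntax; _×_)
open import Relation.Binary.PropositionalEquality using (_≡_; _≢_)

record Graph (n : ℕ) : Set where
  field
    adj   : Fin n → Fin n → Bool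
    sym   : ∀ u v → adj u v ≡ adj v u
    irrfl : ∀ v → adj v v ≡ false
open Graph public

Edge : ∀ {n} → Graph n → Fin n → Fin n → Set
Edge G u v = adj G u v ≡ true

-- A bipartition is a 2-colouring side : Fin n → Bool with X = side⁻¹(true),
-- Y = side⁻¹(false); every edge of G goes between X and Y.
IsBipartition : ∀ {n} → Graph n → (Fin n → Bool) → Set
IsBipartition G side = ∀ u v → Edge G u v → side u ≢ side v

-- An ordering of the class C = side⁻¹(b): a map ρ into ℕ that is injective
-- on C (so it induces a linear order x < x' iff ρ x < ρ x' on C).
IsOrderingOf : ∀ {n} → (Fin n → Bool) → Bool → (Fin n → ℕ) → Set
IsOrderingOf side b ρ = ∀ x x' → side x ≡ b → side x' ≡ b → ρ x ≡ ρ x' → x ≡ x'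

-- Adjacency property: for every vertex y of the other class, N(y) is
-- consecutive in the ordering of the class side⁻¹(b).
AdjacencyProperty : ∀ {n} → Graph n → (Fin n → Bool) → Bool → (Fin n → ℕ) → Set
AdjacencyProperty G side b ρ =
  ∀ y → side y ≢ b → ∀ x₁ x x₂ → side x ≡ b →
  Edge G x₁ y → Edge G x₂ y → ρ x₁ < ρ x → ρ x < ρ x₂ → Edge G x y

Convex : ∀ {n} → Graph n → Set
Convex {n} G = ∃[ side ] (IsBipartition G side ×
  ∃[ b ] ∃[ ρ ] (IsOrderingOf side b ρ × AdjacencyProperty G side b ρ))

allSubsets : ∀ n → List (Subset n)
allSubsets ℕ.zero = [] ∷ []
allSubsets (ℕ.suc n) = map (true ∷_) (allSubsets n) ++ map (false ∷_) (allSubsets n)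

nbhd : ∀ {n} → Graph n → Subset n → Subset n
nbhd {n} G X = tabulate λ v → any (λ x → Data.Vec.lookup X x ∧ adj G x v) (allFin n)

unionNbhds : ∀ {n} → Graph n → Subset n → List (Subset n)
unionNbhds {n} G A =
  deduplicate (≡-dec _≟ᵇ_)
    (map (λ X → ∁ A ∩ nbhd G X) (filter (_⊆? A) (allSubsets n)))

-- 2 ^ cut-bool(A)  (= |UN(A)|)
cutBoolCount : ∀ {n} → Graph n → Subset n → ℕ
cutBoolCount G A = length (unionNbhds G A)

data BTree (n : ℕ) : Set where
  leaf : Fin n → BTree n
  node : BTree n → BTree n → BTree n

leaves : ∀ {n} → BTree n → List (Fin n)
leaves (leaf v) = v ∷ []
leaves (node l r) = leaves l ++ leaves r

leafSet : ∀ {n} → BTree n → Subset n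
leafSet (leaf v) = ⁅ v ⁆
leafSet (node l r) = leafSet l ∪ leafSet r

-- δ is a bijection between V(G) and the leaves
IsDecompTree : ∀ {n} → BTree n → Set
IsDecompTree {n} t = leaves t ↭ allFin n

data Subtree {n : ℕ} (s : BTree n) : BTree n → Set where
  here  : Subtree s s
  left  : ∀ {l r} → Subtree s l → Subtree s (node l r)
  right : ∀ {l r} → Subtree s r → Subtree s (node l r)

-- s hangs below a (non-root) edge of t: each tree edge corresponds to such an s,
-- and the cut it defines is {leafSet s, ∁ (leafSet s)}
data ProperSubtree {n : ℕ} (s : BTree n) : BTree n → Set where
  left  : ∀ {l r} → Subtree s l → ProperSubtree s (node l r)
  right : ∀ {l r} → Subtree s r → ProperSubtree s (node l r)

-- boolean-width of (t, δ) is ≤ log₂ k  ⇔  every cut has |UN(A)| ≤ k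
BoolWidthAtMostLog : ∀ {n} → Graph n → BTree n → ℕ → Set
BoolWidthAtMostLog G t k = ∀ s → ProperSubtree s t →
  cutBoolCount G (leafSet s) ≤ k × cutBoolCount G (∁ (leafSet s)) ≤ k

BoolwAtMostLog : ∀ {n} → Graph n → ℕ → Set
BoolwAtMostLog G k = ∃[ t ] (IsDecompTree t × BoolWidthAtMostLog G t k)

module Submission where

-- Let (X, Y) be the bipartition of a convex graph G, with X ordered by ρ so
-- that every y ∈ Y sees a ρ-interval of X.  Give x ∈ X the key 2ρ(x) and
-- y ∈ Y the key 2·reach(y) + 1, where reach(y) is the largest ρ-value of a
-- neighbour of y: y is placed just after the right end of its interval.
-- Sort the vertices by decreasing key and hang them, in this order, on a
-- caterpillar.  Every cut of the caterpillar separates a single vertex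
-- (cut-bool at most 1) or a "lower cut" A, whose keys are at most all keys
-- outside A.  For a lower cut, every nonempty trace Ā ∩ N(Z) with Z ⊆ A is
-- that of below x, for the ρ-greatest x ∈ Z ∩ X, and every nonempty trace
-- A ∩ N(Z) with Z ⊆ Ā is above c, for the ρ-least c ∈ A ∩ N(Z); here below x
-- and above c are the ρ-initial and ρ-final segments of A ∩ X.  Hence each
-- side of the cut has at most 1 + |A| ≤ n traces.

open import Defs renaming (sym to adj-sym)
open import Data.Nat using (ℕ; suc; _+_; _≤_; _<_; _≤?_; z≤n; s≤s; s≤s⁻¹; _*_)
open import Data.Nat.Properties
  using (≤-trans; ≤-reflexive; ≤-totalOrder; ≤-decTotalOrder; +-suc; *-suc; *-monoʳ-≤;
         ≰⇒>; <⇒≱; 1+n≰n; m≤n⇒m<n∨m≡n; m≤n+m)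
open import Data.Bool using (Bool; true; T; _≟_)
open import Data.Bool.Properties using (T-≡; T-∧; ¬-not; not-injective)
open import Data.Fin using (Fin)
open import Data.Fin.Subset using (Subset; _∈_; _∉_; _⊆_; _∩_; ∁; ⁅_⁆; ⊥)
open import Data.Fin.Subset.Properties
  using (_∈?_; _⊆?_; ⊆-antisym; ⊆-min; ∉⊥; x∈⁅x⁆; x∈⁅y⁆⇒x≡y; x∈∁p⇒x∉p; x∉∁p⇒x∈p;
         x∈p⇒x∉∁p; x∉p⇒x∈∁p; x∈p∩q⁺; x∈p∩q⁻; x∈p∪q⁺; x∈p∪q⁻)
open import Data.Vec using (tabulate)
open import Data.Vec.Properties using (lookup∘tabulate; []=⇒lookup; lookup⇒[]=; ≡-dec)
open import Data.List using (List; []; _∷_; _++_; map; filter; length; allFin)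
open import Data.List.Properties using (length-++; length-map; length-tabulate)
open import Data.List.Membership.Propositional using (lose) renaming (_∈_ to _∈ₗ_)
open import Data.List.Membership.Propositional.Properties
  using (∈-allFin; ∈-map⁺; ∈-map⁻; ∈-filter⁺; ∈-filter⁻; ∈-deduplicate⁻; ∈-∃++;
         ∈-++⁺ˡ; ∈-++⁺ʳ; ∈-++⁻)
open import Data.List.Relation.Unary.Any using (here; there; satisfied)
open import Data.List.Relation.Unary.Any.Properties using (any⁺; any⁻)
open import Data.List.Relation.Unary.All as All using (All; _∷_)
open import Data.List.Relation.Unary.All.Properties using (all-filter)
open import Data.List.Relation.Unary.AllPairs using (AllPairs; _∷_)
open import Data.List.Relation.Unary.Unique.Propositional using (Unique)
open import Data.List.Relation.Unary.Unique.DecPropositional.Properties using (deduplicate-!)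
open import Data.List.Relation.Unary.Sorted.TotalOrder.Properties using (Sorted⇒AllPairs)
open import Data.List.Relation.Binary.Permutation.Propositional using (_↭_; ↭-sym)
open import Data.List.Relation.Binary.Permutation.Propositional.Properties using (∈-resp-↭; ↭-length)
import Data.List.Extrema
open import Data.List.Extrema.Nat using (max; xs≤max; argmax-sel)
import Data.List.Sort
open import Data.Product using (∃-syntax; _×_; _,_; proj₁; proj₂)
open import Data.Sum using (_⊎_; inj₁; inj₂; [_,_])
open import Function using (Equivalence; _∘_; id)
open import Relation.Nullary using (¬_; yes; no; contradiction)
open import Relation.Nullary.Decidable using (isYes; toWitness; fromWitness; _×-dec_)
open import Relation.Unary using (Pred; Decidable)
open import Relation.Binary.Bundles using (TotalOrder; DecTotalOrder)
open import Relation.Binary.PropositionalEquality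
  using (_≡_; _≢_; refl; sym; trans; cong; subst; subst₂; module ≡-Reasoning)
import Relation.Binary.Construct.On as On
import Relation.Binary.Construct.Flip.EqAndOrd as Flip

open Equivalence using (to; from)

private
  variable
    n : ℕ

unique-⊆-length : ∀ {a} {A : Set a} {xs ys : List A} →
  Unique xs → (∀ {x} → x ∈ₗ xs → x ∈ₗ ys) → length xs ≤ length ys
unique-⊆-length {xs = []} _ _ = z≤n
unique-⊆-length {xs = x ∷ xs} (x∉xs ∷ unique) xs⊆ys
  with ys₁ , ys₂ , refl ← ∈-∃++ (xs⊆ys (here refl)) =
  ≤-trans (s≤s (unique-⊆-length unique (λ z∈xs → remove (All.lookup x∉xs z∈xs) (xs⊆ys (there z∈xs)))))
          (≤-reflexive (sym length-insert))
  where
  remove : ∀ {z} → x ≢ z → z ∈ₗ ys₁ ++ x ∷ ys₂ → z ∈ₗ ys₁ ++ ys₂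
  remove x≢z z∈ with ∈-++⁻ ys₁ z∈
  ... | inj₁ z∈ys₁ = ∈-++⁺ˡ z∈ys₁
  ... | inj₂ (here refl) = contradiction refl x≢z
  ... | inj₂ (there z∈ys₂) = ∈-++⁺ʳ ys₁ z∈ys₂
  length-insert : length (ys₁ ++ x ∷ ys₂) ≡ suc (length (ys₁ ++ ys₂))
  length-insert = begin
    length (ys₁ ++ x ∷ ys₂)        ≡⟨ length-++ ys₁ ⟩
    length ys₁ + suc (length ys₂) ≡⟨ +-suc (length ys₁) (length ys₂) ⟩
    suc (length ys₁ + length ys₂) ≡⟨ cong suc (sym (length-++ ys₁)) ⟩
    suc (length (ys₁ ++ ys₂))     ∎
    where open ≡-Reasoning

AllPairs-++ : ∀ {a r} {A : Set a} {R : A → A → Set r} (p : List A) {s} →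
  AllPairs R (p ++ s) → ∀ {c x} → c ∈ₗ p → x ∈ₗ s → R c x
AllPairs-++ (y ∷ p) (y-rel ∷ _) (here refl) x∈s = All.lookup y-rel (∈-++⁺ʳ p x∈s)
AllPairs-++ (y ∷ p) (_ ∷ rest) (there c∈p) x∈s = AllPairs-++ p rest c∈p x∈s

module Extremal {c ℓ₁ ℓ₂} (O : TotalOrder c ℓ₁ ℓ₂) where
  open TotalOrder O using () renaming (Carrier to C; _≤_ to _≼_)
  open Data.List.Extrema O using (argmax; argmax-all; f[xs]≤f[argmax])

  greatest : ∀ {p} {P : Pred (Fin n) p} (f : Fin n → C) → Decidable P →
    (∀ x → ¬ P x) ⊎ ∃[ m ] (P m × ∀ {x} → P x → f x ≼ f m)
  greatest {n} {P = P} f P? with filter P? (allFin n) in eq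
  ... | [] = inj₁ λ x px → contradiction (subst (x ∈ₗ_) eq (∈-filter⁺ P? (∈-allFin x) px)) λ ()
  ... | x₀ ∷ xs = inj₂ (argmax f x₀ (x₀ ∷ xs) , argmax-all f px₀ all-P , bound)
    where
    all-P : All P (x₀ ∷ xs)
    all-P = subst (All P) eq (all-filter P? (allFin n))
    px₀ : P x₀
    px₀ = All.head all-P
    bound : ∀ {x} → P x → f x ≼ f (argmax f x₀ (x₀ ∷ xs))
    bound {x} px = All.lookup (f[xs]≤f[argmax] x₀ (x₀ ∷ xs))
                              (subst (x ∈ₗ_) eq (∈-filter⁺ P? (∈-allFin x) px))

open Extremal ≤-totalOrder using (greatest)
open Extremal (Flip.totalOrder ≤-totalOrder) using () renaming (greatest to least)

module _ {f : Fin n → Bool} {x : Fin n} where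

  ∈-tabulate⁻ : x ∈ tabulate f → T (f x)
  ∈-tabulate⁻ x∈ = from T-≡ (trans (sym (lookup∘tabulate f x)) ([]=⇒lookup x∈))

  ∈-tabulate⁺ : T (f x) → x ∈ tabulate f
  ∈-tabulate⁺ t = lookup⇒[]= x (tabulate f) (trans (lookup∘tabulate f x) (to T-≡ t))

⟦_⟧ : ∀ {p} {P : Pred (Fin n) p} → Decidable P → Subset n
⟦ P? ⟧ = tabulate (λ x → isYes (P? x))

module _ {p} {P : Pred (Fin n) p} {P? : Decidable P} {x : Fin n} where

  ∈⟦⟧⁻ : x ∈ ⟦ P? ⟧ → P x
  ∈⟦⟧⁻ x∈ = toWitness (∈-tabulate⁻ x∈)

  ∈⟦⟧⁺ : P x → x ∈ ⟦ P? ⟧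
  ∈⟦⟧⁺ px = ∈-tabulate⁺ (fromWitness px)

∈∁∁⁻ : ∀ {A : Subset n} {x} → x ∈ ∁ (∁ A) → x ∈ A
∈∁∁⁻ x∈ = x∉∁p⇒x∈p (x∈∁p⇒x∉p x∈)

⊆⁅⁆ : ∀ {X : Subset n} {u} → X ⊆ ⁅ u ⁆ → X ≡ ⊥ ⊎ X ≡ ⁅ u ⁆
⊆⁅⁆ {X = X} {u} X⊆⁅u⁆ with u ∈? X
... | yes u∈X = inj₂ (⊆-antisym X⊆⁅u⁆ (λ x∈⁅u⁆ → subst (_∈ X) (sym (x∈⁅y⁆⇒x≡y u x∈⁅u⁆)) u∈X))
... | no u∉X = inj₁ (⊆-antisym (λ x∈X → contradiction (subst (_∈ X) (x∈⁅y⁆⇒x≡y u (X⊆⁅u⁆ x∈X)) x∈X) u∉X)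
                               (⊆-min X))

module Traces (G : Graph n) where

  edge-sym : ∀ {u v} → Edge G u v → Edge G v u
  edge-sym {u} {v} e = trans (adj-sym G v u) e

  ∈-nbhd⁻ : ∀ {X v} → v ∈ nbhd G X → ∃[ x ] (x ∈ X × Edge G x v)
  ∈-nbhd⁻ {X} {v} v∈ with x , t ← satisfied (any⁻ _ (allFin n) (∈-tabulate⁻ v∈)) =
    x , lookup⇒[]= x X (to T-≡ (proj₁ (to T-∧ t))) , to T-≡ (proj₂ (to T-∧ t))

  ∈-nbhd⁺ : ∀ {X v x} → x ∈ X → Edge G x v → v ∈ nbhd G X
  ∈-nbhd⁺ {X} {v} {x} x∈X e =
    ∈-tabulate⁺ (any⁺ _ (lose (∈-allFin x) (from T-∧ (from T-≡ ([]=⇒lookup x∈X) , from T-≡ e))))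

  ∈-trace⁻ : ∀ {A X v} → v ∈ ∁ A ∩ nbhd G X → v ∉ A × ∃[ x ] (x ∈ X × Edge G x v)
  ∈-trace⁻ {A} {X} v∈ = x∈∁p⇒x∉p (proj₁ (x∈p∩q⁻ (∁ A) _ v∈)) , ∈-nbhd⁻ (proj₂ (x∈p∩q⁻ (∁ A) _ v∈))

  ∈-trace⁺ : ∀ {A X v x} → v ∉ A → x ∈ X → Edge G x v → v ∈ ∁ A ∩ nbhd G X
  ∈-trace⁺ v∉A x∈X e = x∈p∩q⁺ (x∉p⇒x∈∁p v∉A , ∈-nbhd⁺ x∈X e)

  trace-⊥ : ∀ {A} → ∁ A ∩ nbhd G ⊥ ≡ ⊥
  trace-⊥ {A} = ⊆-antisym (λ v∈ → contradiction (proj₁ (proj₂ (proj₂ (∈-trace⁻ v∈)))) ∉⊥) (⊆-min _)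

  cutBoolCount-≤ : ∀ {A} (cands : List (Subset n)) →
    (∀ {X} → X ⊆ A → ∁ A ∩ nbhd G X ∈ₗ cands) → cutBoolCount G A ≤ length cands
  cutBoolCount-≤ {A} cands traces∈ =
    unique-⊆-length (deduplicate-! (≡-dec _≟_) _) λ t∈ →
      trace∈cands (∈-map⁻ _ (∈-deduplicate⁻ _ _ t∈))
    where
    trace∈cands : ∀ {t} → ∃[ X ] (X ∈ₗ filter (_⊆? A) (allSubsets n) × t ≡ ∁ A ∩ nbhd G X) → t ∈ₗ cands
    trace∈cands (X , X∈ , refl) = traces∈ (proj₂ (∈-filter⁻ (_⊆? A) {xs = allSubsets n} X∈))

  cutBoolCount-≤-family : ∀ {A} (S : List (Fin n)) (f : Fin n → Subset n) →
    (∀ {X} → X ⊆ A → ∁ A ∩ nbhd G X ≡ ⊥ ⊎ ∃[ x ] (x ∈ₗ S × ∁ A ∩ nbhd G X ≡ f x)) →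
    cutBoolCount G A ≤ suc (length S)
  cutBoolCount-≤-family S f traces =
    ≤-trans (cutBoolCount-≤ (⊥ ∷ map f S) (λ X⊆A → [ here , there ∘ in-family ] (traces X⊆A)))
            (≤-reflexive (cong suc (length-map f S)))
    where
    in-family : ∀ {t} → ∃[ x ] (x ∈ₗ S × t ≡ f x) → t ∈ₗ map f S
    in-family (x , x∈S , refl) = ∈-map⁺ f x∈S

  cutBool-⁅⁆ : ∀ {u} → cutBoolCount G ⁅ u ⁆ ≤ 2
  cutBool-⁅⁆ {u} = cutBoolCount-≤-family (u ∷ []) (λ _ → ∁ ⁅ u ⁆ ∩ nbhd G ⁅ u ⁆) λ X⊆ → trace (⊆⁅⁆ X⊆)
    where
    trace : ∀ {X} → X ≡ ⊥ ⊎ X ≡ ⁅ u ⁆ →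
      ∁ ⁅ u ⁆ ∩ nbhd G X ≡ ⊥ ⊎ ∃[ x ] (x ∈ₗ u ∷ [] × ∁ ⁅ u ⁆ ∩ nbhd G X ≡ ∁ ⁅ u ⁆ ∩ nbhd G ⁅ u ⁆)
    trace (inj₁ refl) = inj₁ trace-⊥
    trace (inj₂ refl) = inj₂ (u , here refl , refl)

  cutBool-∁⁅⁆ : ∀ {u} → cutBoolCount G (∁ ⁅ u ⁆) ≤ 2
  cutBool-∁⁅⁆ {u} = cutBoolCount-≤-family (u ∷ []) (λ _ → ⁅ u ⁆) λ {X} _ →
    trace (⊆⁅⁆ (λ v∈ → ∈∁∁⁻ (proj₁ (x∈p∩q⁻ (∁ (∁ ⁅ u ⁆)) (nbhd G X) v∈))))
    where
    trace : ∀ {t} → t ≡ ⊥ ⊎ t ≡ ⁅ u ⁆ → t ≡ ⊥ ⊎ ∃[ x ] (x ∈ₗ u ∷ [] × t ≡ ⁅ u ⁆)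
    trace (inj₁ eq) = inj₁ eq
    trace (inj₂ eq) = inj₂ (u , here refl , eq)

∈-leafSet⁻ : ∀ {x : Fin n} t → x ∈ leafSet t → x ∈ₗ leaves t
∈-leafSet⁻ {x = x} (leaf v) x∈ = here (x∈⁅y⁆⇒x≡y v x∈)
∈-leafSet⁻ (node l r) x∈ with x∈p∪q⁻ (leafSet l) (leafSet r) x∈
... | inj₁ x∈l = ∈-++⁺ˡ (∈-leafSet⁻ l x∈l)
... | inj₂ x∈r = ∈-++⁺ʳ (leaves l) (∈-leafSet⁻ r x∈r)

∈-leafSet⁺ : ∀ {x : Fin n} t → x ∈ₗ leaves t → x ∈ leafSet t
∈-leafSet⁺ (leaf v) (here refl) = x∈⁅x⁆ v
∈-leafSet⁺ (node l r) x∈ with ∈-++⁻ (leaves l) x∈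
... | inj₁ x∈l = x∈p∪q⁺ (inj₁ (∈-leafSet⁺ l x∈l))
... | inj₂ x∈r = x∈p∪q⁺ (inj₂ (∈-leafSet⁺ r x∈r))

caterpillar : Fin n → List (Fin n) → BTree n
caterpillar v [] = leaf v
caterpillar v (w ∷ ws) = node (leaf v) (caterpillar w ws)

leaves-caterpillar : ∀ (v : Fin n) vs → leaves (caterpillar v vs) ≡ v ∷ vs
leaves-caterpillar v [] = refl
leaves-caterpillar v (w ∷ ws) = cong (v ∷_) (leaves-caterpillar w ws)

subtree-caterpillar : ∀ {s} (v : Fin n) vs → Subtree s (caterpillar v vs) →
  (∃[ u ] s ≡ leaf u) ⊎
  ∃[ p ] ∃[ u ] ∃[ us ] (s ≡ caterpillar u us × p ++ u ∷ us ≡ v ∷ vs)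
subtree-caterpillar v [] here = inj₂ ([] , v , [] , refl , refl)
subtree-caterpillar v (w ∷ ws) here = inj₂ ([] , v , w ∷ ws , refl , refl)
subtree-caterpillar v (w ∷ ws) (left here) = inj₁ (v , refl)
subtree-caterpillar v (w ∷ ws) (right s≤r) with subtree-caterpillar w ws s≤r
... | inj₁ is-leaf = inj₁ is-leaf
... | inj₂ (p , u , us , refl , eq) = inj₂ (v ∷ p , u , us , refl , cong (v ∷_) eq)

caterpillar-cuts : ∀ {q} (Q : Subset n → Set q) (v w : Fin n) ws →
  (∀ u → Q ⁅ u ⁆) →
  (∀ {p u us} → p ++ u ∷ us ≡ w ∷ ws → Q (leafSet (caterpillar u us))) →
  ∀ s → ProperSubtree s (caterpillar v (w ∷ ws)) → Q (leafSet s)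
caterpillar-cuts Q v w ws single suffix s (left here) = single v
caterpillar-cuts Q v w ws single suffix s (right s≤r) with subtree-caterpillar w ws s≤r
... | inj₁ (u , refl) = single u
... | inj₂ (p , u , us , refl , eq) = suffix eq

-- Comparing the even keys 2ρ(x) of X with the odd keys 2r + 1 of Y.
even≤odd : ∀ a r → 2 * a ≤ suc (2 * r) → a ≤ r
even≤odd a r 2a≤2r+1 with a ≤? r
... | yes a≤r = a≤r
... | no a≰r = contradiction 2r+2≤2r+1 1+n≰n
  where
  2r+2≤2r+1 : suc (suc (2 * r)) ≤ suc (2 * r)
  2r+2≤2r+1 = ≤-trans (≤-reflexive (sym (*-suc 2 r))) (≤-trans (*-monoʳ-≤ 2 (≰⇒> a≰r)) 2a≤2r+1)

odd≤even : ∀ a r → suc (2 * r) ≤ 2 * a → r < a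
odd≤even a r 2r+1≤2a with suc r ≤? a
... | yes r<a = r<a
... | no r≮a = contradiction (≤-trans 2r+1≤2a (*-monoʳ-≤ 2 (s≤s⁻¹ (≰⇒> r≮a)))) 1+n≰n

module ConvexLayout {n} (G : Graph n) (side : Fin n → Bool) (bipartite : IsBipartition G side)
  (b : Bool) (ρ : Fin n → ℕ) (ρ-injective : IsOrderingOf side b ρ)
  (consecutive : AdjacencyProperty G side b ρ) where

  open Traces G

  InX : Fin n → Set
  InX v = side v ≡ b

  edge-to-X : ∀ {u v} → Edge G u v → ¬ InX u → InX v
  edge-to-X {u} {v} e u∉X = not-injective (trans (sym (¬-not (bipartite u v e))) (¬-not u∉X))

  edge-from-X : ∀ {u v} → Edge G u v → InX u → ¬ InX v
  edge-from-X {u} {v} e u∈X v∈X = bipartite u v e (trans u∈X (sym v∈X))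

  interval : ∀ {y x₁ x x₂} → ¬ InX y → InX x → Edge G x₁ y → Edge G x₂ y →
    ρ x₁ ≤ ρ x → ρ x ≤ ρ x₂ → Edge G x y
  interval {y} {x₁} {x} {x₂} y∉X x∈X e₁ e₂ ρ₁≤ρ ρ≤ρ₂
    with m≤n⇒m<n∨m≡n ρ₁≤ρ | m≤n⇒m<n∨m≡n ρ≤ρ₂
  ... | inj₂ ρ₁≡ρ | _ =
    subst (λ z → Edge G z y) (ρ-injective x₁ x (edge-to-X (edge-sym e₁) y∉X) x∈X ρ₁≡ρ) e₁
  ... | inj₁ _ | inj₂ ρ≡ρ₂ =
    subst (λ z → Edge G z y) (sym (ρ-injective x x₂ x∈X (edge-to-X (edge-sym e₂) y∉X) ρ≡ρ₂)) e₂
  ... | inj₁ ρ₁<ρ | inj₁ ρ<ρ₂ = consecutive y y∉X x₁ x x₂ x∈X e₁ e₂ ρ₁<ρ ρ<ρ₂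

  neighbours : Fin n → List (Fin n)
  neighbours y = filter (λ w → adj G w y ≟ true) (allFin n)

  -- The right end of the interval N(y): the largest ρ-value of a neighbour
  -- of y (0 if y is isolated).
  reach : Fin n → ℕ
  reach y = max 0 (map ρ (neighbours y))

  reach-upper : ∀ {w y} → Edge G w y → ρ w ≤ reach y
  reach-upper {w} {y} e =
    All.lookup (xs≤max 0 (map ρ (neighbours y)))
               (∈-map⁺ ρ (∈-filter⁺ (λ w → adj G w y ≟ true) (∈-allFin w) e))

  reach-attained : ∀ {e y k} → Edge G e y → k ≤ reach y → ∃[ w ] (Edge G w y × k ≤ ρ w)
  reach-attained {e} {y} {k} edge k≤reach with argmax-sel id 0 (map ρ (neighbours y))
  ... | inj₁ reach≡0 = e , edge , ≤-trans (≤-trans k≤reach (≤-reflexive reach≡0)) z≤n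
  ... | inj₂ reach∈ with w , w∈ , reach≡ρw ← ∈-map⁻ ρ reach∈ =
    w , proj₂ (∈-filter⁻ (λ w → adj G w y ≟ true) {xs = allFin n} w∈) ,
    ≤-trans k≤reach (≤-reflexive reach≡ρw)

  -- The layout key: x ∈ X sits at 2ρ(x), y ∈ Y just after the right end of N(y).
  key : Fin n → ℕ
  key v with side v ≟ b
  ... | yes _ = 2 * ρ v
  ... | no _ = suc (2 * reach v)

  key-X : ∀ {v} → InX v → key v ≡ 2 * ρ v
  key-X {v} v∈X with side v ≟ b
  ... | yes _ = refl
  ... | no v∉X = contradiction v∈X v∉X

  key-Y : ∀ {v} → ¬ InX v → key v ≡ suc (2 * reach v)
  key-Y {v} v∉X with side v ≟ b
  ... | yes v∈X = contradiction v∈X v∉X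
  ... | no _ = refl

  module LowerCut (A : Subset n) (lower : ∀ {a c} → a ∈ A → c ∉ A → key a ≤ key c) where

    -- An edge leaving A starts in X: a vertex of A ∩ Y lies after all its neighbours.
    leaving-from-X : ∀ {a c} → a ∈ A → c ∉ A → Edge G a c → InX a
    leaving-from-X {a} {c} a∈A c∉A e with side a ≟ b
    ... | yes a∈X = a∈X
    ... | no a∉X = contradiction (reach-upper (edge-sym e)) (<⇒≱ (odd≤even (ρ c) (reach a) keys))
      where
      keys : suc (2 * reach a) ≤ 2 * ρ c
      keys = subst₂ _≤_ (key-Y a∉X) (key-X (edge-to-X e a∉X)) (lower a∈A c∉A)

    below-reach : ∀ {x y} → x ∈ A → InX x → y ∉ A → ¬ InX y → ρ x ≤ reach y
    below-reach {x} {y} x∈A x∈X y∉A y∉X =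
      even≤odd (ρ x) (reach y) (subst₂ _≤_ (key-X x∈X) (key-Y y∉X) (lower x∈A y∉A))

    -- The key step: if y ∉ A sees z ∈ X with ρ z ≤ ρ x, for x ∈ A ∩ X, then
    -- y also sees x, since x lies between z and the right end of N(y).
    bridge : ∀ {x y z} → x ∈ A → InX x → y ∉ A → InX z → Edge G z y → ρ z ≤ ρ x → Edge G x y
    bridge x∈A x∈X y∉A z∈X e ρz≤ρx =
      let y∉X = edge-from-X e z∈X
          w , ew , ρx≤ρw = reach-attained e (below-reach x∈A x∈X y∉A y∉X)
      in interval y∉X x∈X e ew ρz≤ρx ρx≤ρw

    below : Fin n → Subset n
    below x = ⟦ (λ z → z ∈? A ×-dec side z ≟ b ×-dec ρ z ≤? ρ x) ⟧

    above : Fin n → Subset n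
    above c = ⟦ (λ z → z ∈? A ×-dec side z ≟ b ×-dec ρ c ≤? ρ z) ⟧

    outer-trace : ∀ {Z} → Z ⊆ A →
      ∁ A ∩ nbhd G Z ≡ ⊥ ⊎ ∃[ x ] (x ∈ A × ∁ A ∩ nbhd G Z ≡ ∁ A ∩ nbhd G (below x))
    outer-trace {Z} Z⊆A with greatest ρ (λ z → z ∈? Z ×-dec side z ≟ b)
    ... | inj₁ none = inj₁ (⊆-antisym empty (⊆-min _))
      where
      empty : ∁ A ∩ nbhd G Z ⊆ ⊥
      empty v∈ =
        let v∉A , x , x∈Z , e = ∈-trace⁻ v∈
        in contradiction (x∈Z , leaving-from-X (Z⊆A x∈Z) v∉A e) (none x)
    ... | inj₂ (m , (m∈Z , m∈X) , m-greatest) = inj₂ (m , Z⊆A m∈Z , ⊆-antisym to-below from-below)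
      where
      to-below : ∁ A ∩ nbhd G Z ⊆ ∁ A ∩ nbhd G (below m)
      to-below v∈ =
        let v∉A , x , x∈Z , e = ∈-trace⁻ v∈
            x∈X = leaving-from-X (Z⊆A x∈Z) v∉A e
        in ∈-trace⁺ v∉A (∈⟦⟧⁺ (Z⊆A x∈Z , x∈X , m-greatest (x∈Z , x∈X))) e
      from-below : ∁ A ∩ nbhd G (below m) ⊆ ∁ A ∩ nbhd G Z
      from-below v∈ =
        let v∉A , z , z∈below , e = ∈-trace⁻ v∈
            _ , z∈X , ρz≤ρm = ∈⟦⟧⁻ z∈below
        in ∈-trace⁺ v∉A m∈Z (bridge (Z⊆A m∈Z) m∈X v∉A z∈X e ρz≤ρm)

    inner-trace⁻ : ∀ {Z v} → Z ⊆ ∁ A → v ∈ ∁ (∁ A) ∩ nbhd G Z →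
      v ∈ A × InX v × ∃[ y ] (y ∈ Z × y ∉ A × Edge G y v)
    inner-trace⁻ Z⊆Ā v∈ =
      let v∉Ā , y , y∈Z , e = ∈-trace⁻ v∈
          v∈A = x∉∁p⇒x∈p v∉Ā
          y∉A = x∈∁p⇒x∉p (Z⊆Ā y∈Z)
      in v∈A , leaving-from-X v∈A y∉A (edge-sym e) , y , y∈Z , y∉A , e

    inner-trace : ∀ {Z} → Z ⊆ ∁ A →
      ∁ (∁ A) ∩ nbhd G Z ≡ ⊥ ⊎ ∃[ c ] (c ∈ A × ∁ (∁ A) ∩ nbhd G Z ≡ above c)
    inner-trace {Z} Z⊆Ā with least ρ (_∈? ∁ (∁ A) ∩ nbhd G Z)
    ... | inj₁ none = inj₁ (⊆-antisym (λ {v} v∈ → contradiction v∈ (none v)) (⊆-min _))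
    ... | inj₂ (c , c∈ , c-least) = inj₂ (c , c∈A , ⊆-antisym to-above from-above)
      where
      c∈A : c ∈ A
      c∈A = proj₁ (inner-trace⁻ Z⊆Ā c∈)
      c∈X : InX c
      c∈X = proj₁ (proj₂ (inner-trace⁻ Z⊆Ā c∈))
      to-above : ∁ (∁ A) ∩ nbhd G Z ⊆ above c
      to-above v∈ =
        let v∈A , v∈X , _ = inner-trace⁻ Z⊆Ā v∈
        in ∈⟦⟧⁺ (v∈A , v∈X , c-least v∈)
      from-above : above c ⊆ ∁ (∁ A) ∩ nbhd G Z
      from-above v∈ =
        let v∈A , v∈X , ρc≤ρv = ∈⟦⟧⁻ v∈
            _ , _ , y , y∈Z , y∉A , e = inner-trace⁻ Z⊆Ā c∈
        in ∈-trace⁺ (x∈p⇒x∉∁p v∈A) y∈Z (edge-sym (bridge v∈A v∈X y∉A c∈X (edge-sym e) ρc≤ρv))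

    cutBool-bound : (S : List (Fin n)) → (∀ {a} → a ∈ A → a ∈ₗ S) →
      cutBoolCount G A ≤ suc (length S) × cutBoolCount G (∁ A) ≤ suc (length S)
    cutBool-bound S A⊆S =
      cutBoolCount-≤-family S outer (λ Z⊆A → listed outer (outer-trace Z⊆A)) ,
      cutBoolCount-≤-family S above (λ Z⊆Ā → listed above (inner-trace Z⊆Ā))
      where
      outer : Fin n → Subset n
      outer x = ∁ A ∩ nbhd G (below x)
      listed : ∀ {t} (f : Fin n → Subset n) →
        t ≡ ⊥ ⊎ ∃[ x ] (x ∈ A × t ≡ f x) → t ≡ ⊥ ⊎ ∃[ x ] (x ∈ₗ S × t ≡ f x)
      listed f (inj₁ t≡⊥) = inj₁ t≡⊥
      listed f (inj₂ (x , x∈A , t≡fx)) = inj₂ (x , A⊆S x∈A , t≡fx)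

  byKey : DecTotalOrder _ _ _
  byKey = On.decTotalOrder (Flip.decTotalOrder ≤-decTotalOrder) key

  open Data.List.Sort byKey using (sort; sort-↭; sort-↗)

  sorted : List (Fin n)
  sorted = sort (allFin n)

  sorted-length : length sorted ≡ n
  sorted-length = trans (↭-length (sort-↭ (allFin n))) (length-tabulate id)

  sorted-decreasing : AllPairs (λ x y → key y ≤ key x) sorted
  sorted-decreasing = Sorted⇒AllPairs (DecTotalOrder.totalOrder byKey) (sort-↗ (allFin n))

  suffix-cut : ∀ {q p u us} → q ∷ p ++ u ∷ us ≡ sorted →
    cutBoolCount G (leafSet (caterpillar u us)) ≤ n × cutBoolCount G (∁ (leafSet (caterpillar u us))) ≤ n
  suffix-cut {q} {p} {u} {us} split =
    let bound₁ , bound₂ = LowerCut.cutBool-bound A lower (u ∷ us) A⊆S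
    in ≤-trans bound₁ size , ≤-trans bound₂ size
    where
    A : Subset n
    A = leafSet (caterpillar u us)
    A⊆S : ∀ {a} → a ∈ A → a ∈ₗ u ∷ us
    A⊆S a∈A = subst (_ ∈ₗ_) (leaves-caterpillar u us) (∈-leafSet⁻ (caterpillar u us) a∈A)
    lower : ∀ {a c} → a ∈ A → c ∉ A → key a ≤ key c
    lower {a} {c} a∈A c∉A
      with ∈-++⁻ (q ∷ p) (subst (c ∈ₗ_) (sym split) (∈-resp-↭ (↭-sym (sort-↭ (allFin n))) (∈-allFin c)))
    ... | inj₁ c∈prefix =
      AllPairs-++ (q ∷ p) (subst (AllPairs _) (sym split) sorted-decreasing) c∈prefix (A⊆S a∈A)
    ... | inj₂ c∈S = contradiction
      (∈-leafSet⁺ (caterpillar u us) (subst (c ∈ₗ_) (sym (leaves-caterpillar u us)) c∈S)) c∉A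
    size : suc (length (u ∷ us)) ≤ n
    size = ≤-trans (s≤s (m≤n+m (length (u ∷ us)) (length p))) (≤-reflexive (begin
      suc (length p + length (u ∷ us)) ≡⟨ cong suc (sym (length-++ p)) ⟩
      length (q ∷ p ++ u ∷ us)          ≡⟨ cong length split ⟩
      length sorted                     ≡⟨ sorted-length ⟩
      n                                 ∎))
      where open ≡-Reasoning

  layout : 1 ≤ n → BoolwAtMostLog G n
  layout 1≤n with sorted in sorted≡
  ... | [] = contradiction (subst (1 ≤_) (trans (sym sorted-length) (cong length sorted≡)) 1≤n) λ ()
  ... | v ∷ [] = leaf v , subst (_↭ allFin n) sorted≡ (sort-↭ (allFin n)) , λ _ ()
  ... | v ∷ w ∷ ws =
    caterpillar v (w ∷ ws) ,
    subst (_↭ allFin n) (trans sorted≡ (sym (leaves-caterpillar v (w ∷ ws)))) (sort-↭ (allFin n)) ,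
    caterpillar-cuts (λ A → cutBoolCount G A ≤ n × cutBoolCount G (∁ A) ≤ n) v w ws
      (λ u → ≤-trans cutBool-⁅⁆ 2≤n , ≤-trans cutBool-∁⁅⁆ 2≤n)
      (λ split → suffix-cut (trans (cong (v ∷_) split) (sym sorted≡)))
    where
    2≤n : 2 ≤ n
    2≤n = subst (2 ≤_) (trans (cong length (sym sorted≡)) sorted-length) (s≤s (s≤s z≤n))

mainTheorem7 : ∀ {n : ℕ} (G : Graph n) → 1 ≤ n → Convex G → BoolwAtMostLog G n
mainTheorem7 G 1≤n (side , bipartite , b , ρ , ρ-injective , consecutive) =
  ConvexLayout.layout G side bipartite b ρ ρ-injective consecutive 1≤n
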